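{- Let $m$ be a positive integer. For every positive integer $n$, the triangular number $T_n$ is a member of infinitely many $D(m^2)$-triples of triangular numbers; that is, there are infinitely many sets $\{a,b,c\}$ of three distinct triangular numbers with $T_n \in \{a,b,c\}$ such that $ab+m^2$, $ac+m^2$ and $bc+m^2$ are all perfect squares.
   Context: For a positive integer $k$, the $k$-th triangular number is $T_k = \frac{k(k+1)}{2}$; a triangular number is any $T_k$ with $k$ a positive integer. For a nonzero integer $d$, a $D(d)$-triple is a set of three distinct positive integers such that the product of any two distinct elements increased by $d$ is a perfect square. -}

module Defs where

open import Data.Nat using (ℕ; suc; _+_; _*_; _/_; _^_; _<_; _≤_)
open import Data.Product using (∃-syntax; _×_)
open import Relation.Binary.PropositionalEquality using (_≡_; _≢_)

T : ℕ → ℕ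
T k = (k * (k + 1)) / 2

IsTriangular : ℕ → Set
IsTriangular x = ∃[ k ] (1 ≤ k × x ≡ T k)

IsSquare : ℕ → Set
IsSquare x = ∃[ s ] (x ≡ s * s)

-- {a,b,c} is a D(d)-triple (d > 0, so everything stays in ℕ):
-- three distinct positive integers with all pairwise products + d squares
IsDTriple : ℕ → ℕ → ℕ → ℕ → Set
IsDTriple d a b c =
  (1 ≤ a × 1 ≤ b × 1 ≤ c) ×
  (a ≢ b × a ≢ c × b ≢ c) ×
  (IsSquare (a * b + d) × IsSquare (a * c + d) × IsSquare (b * c + d))

{-# OPTIONS --safe #-}
module Submission where

-- D(M)-pairs among numbers t with c t + 1 a square extend: if c a + 1 = x², c b + 1 = y²
-- and a b + M = g², then the t with c t + 1 = (x y + c g)² satisfies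
-- a t + M = (a y + x g)² and b t + M = (b x + y g)². Triangular numbers are the case c = 8,
-- since 8 T k + 1 = (2k + 1)², and then t = T l with 2l + 1 = (2n + 1)(2k + 1) + 8g for
-- a = T n, b = T k. Iterating this from the pair {T n, T 0}, whose square is m², gives
-- ever larger triangular D(m²)-partners of T n, and any partner together with the next
-- one forms a D(m²)-triple with T n.

open import Defs
open import Data.Nat
  using (ℕ; zero; suc; _+_; _*_; _/_; _^_; _<_; _≤_; _⊔_; z≤n; s≤s; z<s; NonZero)
open import Data.Nat.DivMod using (m*n/n≡m)
open import Data.Nat.GeneralisedArithmetic using (fold)
open import Data.Nat.Properties
open import Data.Nat.Tactic.RingSolver using (solve)
open import Data.List using (_∷_; [])
open import Data.Product using (∃-syntax; _×_; _,_; proj₁; proj₂)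
open import Relation.Binary.PropositionalEquality
open ≡-Reasoning

-- Multiplied by c and shifted by a, the identity needs no subtraction to trade x², y², g²
-- for c a + 1, c b + 1, a b + M.
D-pair-extension-square : ∀ c .{{_ : NonZero c}} x y g {a b M t} →
  c * a + 1 ≡ x * x → c * b + 1 ≡ y * y → a * b + M ≡ g * g →
  c * t + 1 ≡ (x * y + c * g) * (x * y + c * g) →
  a * t + M ≡ (a * y + x * g) * (a * y + x * g)
D-pair-extension-square c x y g {a} {b} {M} {t} hx hy hg ht =
  *-cancelˡ-≡ _ _ c (+-cancelʳ-≡ a _ _ (begin
    c * (a * t + M) + a
      ≡⟨ solve (c ∷ a ∷ M ∷ t ∷ []) ⟩
    a * (c * t + 1) + c * M
      ≡⟨ cong (λ w → a * w + c * M) ht ⟩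
    a * ((x * y + c * g) * (x * y + c * g)) + c * M
      ≡⟨ solve (c ∷ a ∷ M ∷ x ∷ y ∷ g ∷ []) ⟩
    a * (x * x) * (y * y) + 2 * c * a * x * y * g + c * c * a * (g * g) + c * M
      ≡⟨ cong (λ w → w + 2 * c * a * x * y * g + c * c * a * (g * g) + c * M) ax²y² ⟩
    c * a * a * (y * y) + c * a * b + a + 2 * c * a * x * y * g + c * c * a * (g * g) + c * M
      ≡⟨ solve (c ∷ a ∷ b ∷ M ∷ x ∷ y ∷ g ∷ []) ⟩
    c * a * a * (y * y) + 2 * c * a * x * y * g + (c * c * a * (g * g) + c * a * b + c * M) + a
      ≡⟨ cong (λ w → c * a * a * (y * y) + 2 * c * a * x * y * g + w + a) cx²g² ⟨
    c * a * a * (y * y) + 2 * c * a * x * y * g + c * (x * x) * (g * g) + a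
      ≡⟨ solve (c ∷ a ∷ x ∷ y ∷ g ∷ []) ⟩
    c * ((a * y + x * g) * (a * y + x * g)) + a ∎))
  where
  ax²y² : a * (x * x) * (y * y) ≡ c * a * a * (y * y) + c * a * b + a
  ax²y² = begin
    a * (x * x) * (y * y)                 ≡⟨ cong (λ w → a * w * (y * y)) hx ⟨
    a * (c * a + 1) * (y * y)             ≡⟨ solve (c ∷ a ∷ y ∷ []) ⟩
    c * a * a * (y * y) + a * (y * y)     ≡⟨ cong (λ w → c * a * a * (y * y) + a * w) hy ⟨
    c * a * a * (y * y) + a * (c * b + 1) ≡⟨ solve (c ∷ a ∷ b ∷ y ∷ []) ⟩
    c * a * a * (y * y) + c * a * b + a   ∎

  cx²g² : c * (x * x) * (g * g) ≡ c * c * a * (g * g) + c * a * b + c * M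
  cx²g² = begin
    c * (x * x) * (g * g)                 ≡⟨ cong (λ w → c * w * (g * g)) hx ⟨
    c * (c * a + 1) * (g * g)             ≡⟨ solve (c ∷ a ∷ g ∷ []) ⟩
    c * c * a * (g * g) + c * (g * g)     ≡⟨ cong (λ w → c * c * a * (g * g) + c * w) hg ⟨
    c * c * a * (g * g) + c * (a * b + M) ≡⟨ solve (c ∷ a ∷ b ∷ M ∷ g ∷ []) ⟩
    c * c * a * (g * g) + c * a * b + c * M ∎

D-pair-extension : ∀ c .{{_ : NonZero c}} x y g {a b M t} →
  c * a + 1 ≡ x * x → c * b + 1 ≡ y * y → a * b + M ≡ g * g →
  c * t + 1 ≡ (x * y + c * g) * (x * y + c * g) →
  IsSquare (a * t + M) × IsSquare (b * t + M)
D-pair-extension c x y g {a} {b} {M} hx hy hg ht =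
  (a * y + x * g , D-pair-extension-square c x y g hx hy hg ht) ,
  (b * x + y * g , D-pair-extension-square c y x g hy hx
         (trans (cong (_+ M) (*-comm b a)) hg)
         (trans ht (cong (λ w → (w + c * g) * (w + c * g)) (*-comm x y))))

k*[k+1]-even : ∀ k → ∃[ q ] k * (k + 1) ≡ q * 2
k*[k+1]-even zero = 0 , refl
k*[k+1]-even (suc k) with q , eq ← k*[k+1]-even k = q + suc k , (begin
  suc k * (suc k + 1)     ≡⟨ solve (k ∷ []) ⟩
  k * (k + 1) + suc k * 2 ≡⟨ cong (_+ suc k * 2) eq ⟩
  q * 2 + suc k * 2       ≡⟨ *-distribʳ-+ 2 q (suc k) ⟨
  (q + suc k) * 2         ∎)

2*T[k]≡k*[k+1] : ∀ k → 2 * T k ≡ k * (k + 1)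
2*T[k]≡k*[k+1] k with q , eq ← k*[k+1]-even k = begin
  2 * T k         ≡⟨ cong (λ p → 2 * (p / 2)) eq ⟩
  2 * (q * 2 / 2) ≡⟨ cong (2 *_) (m*n/n≡m q 2) ⟩
  2 * q           ≡⟨ *-comm 2 q ⟩
  q * 2           ≡⟨ eq ⟨
  k * (k + 1)     ∎

8*T[k]+1≡[2k+1]² : ∀ k → 8 * T k + 1 ≡ (2 * k + 1) * (2 * k + 1)
8*T[k]+1≡[2k+1]² k = begin
  8 * T k + 1           ≡⟨ cong (_+ 1) (*-assoc 4 2 (T k)) ⟩
  4 * (2 * T k) + 1     ≡⟨ cong (λ p → 4 * p + 1) (2*T[k]≡k*[k+1] k) ⟩
  4 * (k * (k + 1)) + 1 ≡⟨ solve (k ∷ []) ⟩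
  (2 * k + 1) * (2 * k + 1) ∎

T-mono-< : ∀ {k l} → k < l → T k < T l
T-mono-< {k} {l} k<l = *-cancelˡ-< 2 (T k) (T l)
  (subst₂ _<_ (sym (2*T[k]≡k*[k+1] k)) (sym (2*T[k]≡k*[k+1] l))
    (*-mono-< k<l (+-monoˡ-< 1 k<l)))

n≤T[n] : ∀ n → n ≤ T n
n≤T[n] zero = z≤n
n≤T[n] n@(suc _) = *-cancelˡ-≤ 2
  (subst₂ _≤_ (*-comm n 2) (sym (2*T[k]≡k*[k+1] n))
    (*-monoʳ-≤ n (+-monoˡ-≤ 1 (s≤s z≤n))))

extensionIndex : ℕ → ℕ → ℕ → ℕ
extensionIndex n k g = n + k + 2 * n * k + 4 * g

2*extensionIndex+1 : ∀ n k g →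
  2 * extensionIndex n k g + 1 ≡ (2 * n + 1) * (2 * k + 1) + 8 * g
2*extensionIndex+1 n k g = begin
  2 * extensionIndex n k g + 1        ≡⟨⟩
  2 * (n + k + 2 * n * k + 4 * g) + 1 ≡⟨ solve (n ∷ k ∷ g ∷ []) ⟩
  (2 * n + 1) * (2 * k + 1) + 8 * g   ∎

n+k≤extensionIndex : ∀ n k g → n + k ≤ extensionIndex n k g
n+k≤extensionIndex n k g = ≤-trans (m≤m+n (n + k) (2 * n * k)) (m≤m+n _ (4 * g))

k<extensionIndex : ∀ {n} k g → 1 ≤ n → k < extensionIndex n k g
k<extensionIndex {n} k g 1≤n = <-≤-trans (m<n+m k 1≤n) (n+k≤extensionIndex n k g)

T-extension : ∀ {M} n k g → T n * T k + M ≡ g * g →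
  IsSquare (T n * T (extensionIndex n k g) + M) × IsSquare (T k * T (extensionIndex n k g) + M)
T-extension {M} n k g eq =
  D-pair-extension 8 (2 * n + 1) (2 * k + 1) g {T n} {T k} {M} {T (extensionIndex n k g)}
  (8*T[k]+1≡[2k+1]² n) (8*T[k]+1≡[2k+1]² k) eq
  (trans (8*T[k]+1≡[2k+1]² (extensionIndex n k g))
         (cong (λ z → z * z) (2*extensionIndex+1 n k g)))

TriangularPartner : ℕ → ℕ → Set
TriangularPartner M a = ∃[ k ] IsSquare (a * T k + M)

extendPartner : ∀ {M} n → TriangularPartner M (T n) → TriangularPartner M (T n)
extendPartner n (k , g , eq) = extensionIndex n k g , proj₁ (T-extension n k g eq)

partners : ∀ {M} n → IsSquare M → ℕ → TriangularPartner M (T n)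
partners {M} n (g , M≡g*g) =
  fold (0 , g , trans (cong (_+ M) (*-zeroʳ (T n))) M≡g*g) (extendPartner n)

i+n≤partner : ∀ {M} n (M-square : IsSquare M) → 1 ≤ n → ∀ i →
  i + n ≤ proj₁ (partners n M-square (suc i))
i+n≤partner n M-square 1≤n zero =
  ≤-trans (m≤m+n n 0) (n+k≤extensionIndex n 0 (proj₁ M-square))
i+n≤partner n M-square 1≤n (suc i) =
  ≤-trans (s≤s (i+n≤partner n M-square 1≤n i)) (k<extensionIndex k g 1≤n)
  where
  k g : ℕ
  k = proj₁ (partners n M-square (suc i))
  g = proj₁ (proj₂ (partners n M-square (suc i)))

partner-triple : ∀ {M n k g} → 1 ≤ n → n < k → T n * T k + M ≡ g * g →
  IsDTriple M (T n) (T k) (T (extensionIndex n k g))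
partner-triple {n = n} {k} {g} 1≤n n<k eq =
  (T-mono-< 1≤n , T-mono-< (m<n⇒0<n n<k) , T-mono-< (m<n⇒0<n n<l)) ,
  (<⇒≢ (T-mono-< n<k) , <⇒≢ (T-mono-< n<l) , <⇒≢ (T-mono-< k<l)) ,
  (g , eq) , T-extension n k g eq
  where
  k<l : k < extensionIndex n k g
  k<l = k<extensionIndex k g 1≤n
  n<l : n < extensionIndex n k g
  n<l = <-trans n<k k<l

theorem1p1 : (m : ℕ) → 1 ≤ m → (n : ℕ) → 1 ≤ n → (N : ℕ) →
    ∃[ b ] ∃[ c ] (IsTriangular b × IsTriangular c ×
    IsDTriple (m ^ 2) (T n) b c × N < b ⊔ c)
theorem1p1 m _ n 1≤n N =
  T k , T l , (k , m<n⇒0<n n<k , refl) , (l , m<n⇒0<n (<-trans n<k k<l) , refl) ,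
  partner-triple {g = g} 1≤n n<k eq , m<n⇒m<n⊔o (T l) (<-≤-trans N<k (n≤T[n] k))
  where
  m² : IsSquare (m ^ 2)
  m² = m , cong (m *_) (*-identityʳ m)
  partner : TriangularPartner (m ^ 2) (T n)
  partner = partners n m² (suc (suc N))
  k g l : ℕ
  k = proj₁ partner
  g = proj₁ (proj₂ partner)
  l = extensionIndex n k g
  eq : T n * T k + m ^ 2 ≡ g * g
  eq = proj₂ (proj₂ partner)
  N+n<k : suc N + n ≤ k
  N+n<k = i+n≤partner n m² 1≤n (suc N)
  n<k : n < k
  n<k = <-≤-trans (m<n+m n z<s) N+n<k
  N<k : N < k
  N<k = ≤-trans (m≤m+n (suc N) n) N+n<k
  k<l : k < l
  k<l = k<extensionIndex k g 1≤n
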